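{- Let $d_1, d_2, \ell_1, \ell_2$ be positive integers and let \[ P_1 = \{0, d_1, 2d_1, \dots, (\ell_1 - 1)d_1\}, \qquad P_2 = \{ -(\ell_2 - 1)d_2, \dots, -2d_2, -d_2, 0\}. \] If $d_1 \neq d_2$, then the number of pairs $(a_1,a_2) \in P_1 \times P_2$ with $a_1 + a_2 \notin P_1 \cup P_2$ is at least \[ \tfrac{1}{4}\min(\ell_1^2, \ell_2^2) - \tfrac{1}{2}(\ell_1 - \ell_2)^2 - \ell_1 - \ell_2. \] -}

module Defs where

open import Data.Nat using (ℕ; suc)
open import Data.Integer using (ℤ; +_; -_; _*_; _+_)
open import Data.List using (List; map; upTo; cartesianProduct; filter; length)
open import Data.List.Membership.DecPropositional using () renaming (_∈?_ to mem?)
open import Data.Integer.Properties using (_≟_)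
open import Data.Product using (_×_; _,_)
open import Relation.Nullary using (¬?)
open import Data.Sum using (_⊎_)
open import Relation.Nullary.Decidable using (_⊎-dec_)
open import Data.List.Membership.Propositional using (_∈_)

P₁ : ℕ → ℕ → List ℤ
P₁ d₁ ℓ₁ = map (λ i → + (i Data.Nat.* d₁)) (upTo ℓ₁)

P₂ : ℕ → ℕ → List ℤ
P₂ d₂ ℓ₂ = map (λ j → - (+ (j Data.Nat.* d₂))) (upTo ℓ₂)

-- number of pairs (a₁ , a₂) ∈ P₁ × P₂ with a₁ + a₂ ∉ P₁ ∪ P₂
-- (the elements of P₁, P₂ are listed without repetition since d₁, d₂ > 0)
badPairs : ℕ → ℕ → ℕ → ℕ → ℕ
badPairs d₁ d₂ ℓ₁ ℓ₂ =
  length (filter (λ { (a₁ , a₂) →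
            ¬? (mem? _≟_ (a₁ + a₂) (P₁ d₁ ℓ₁) ⊎-dec mem? _≟_ (a₁ + a₂) (P₂ d₂ ℓ₂)) })
         (cartesianProduct (P₁ d₁ ℓ₁) (P₂ d₂ ℓ₂)))

module Submission where

-- We prove the stronger m² ≤ 4B + m for m = min(ℓ₁, ℓ₂).  Say d₂ < d₁ (the other case
-- is symmetric).  For j ≤ i the sum i·d₁ − j·d₂ is nonnegative, so it can only lie in
-- P₁ ∪ P₂ if it is a multiple of d₁, i.e. if d₁ ∣ j·d₂.  Since d₁ ∤ d₂, this never
-- happens for two consecutive j, so row i < m of the grid contains at least i/2 bad
-- pairs, and summing over the rows gives (m² − m)/4.

open import Defs

module FiniteSums where

  open import Data.Nat
  open import Data.Nat.Properties
  open import Data.Nat.Tactic.RingSolver using (solve-∀)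
  open import Data.Sum using (_⊎_; inj₁; inj₂)
  open import Relation.Binary.PropositionalEquality

  ∑ : ℕ → (ℕ → ℕ) → ℕ
  ∑ zero    f = 0
  ∑ (suc n) f = ∑ n f + f n

  ∑-mono-≤ : ∀ n {f g : ℕ → ℕ} → (∀ {k} → k < n → f k ≤ g k) → ∑ n f ≤ ∑ n g
  ∑-mono-≤ zero    f≤g = z≤n
  ∑-mono-≤ (suc n) f≤g = +-mono-≤ (∑-mono-≤ n (λ k<n → f≤g (m<n⇒m<1+n k<n))) (f≤g (n<1+n n))

  ∑-extend : ∀ f {m n} → m ≤ n → ∑ m f ≤ ∑ n f
  ∑-extend f {n = zero} z≤n = z≤n
  ∑-extend f {m} {suc n} m≤1+n with m≤n⇒m<n∨m≡n m≤1+n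
  ... | inj₁ m<1+n = ≤-trans (∑-extend f (s≤s⁻¹ m<1+n)) (m≤m+n (∑ n f) (f n))
  ... | inj₂ refl  = ≤-refl

  ∑-zero : ∀ n → ∑ n (λ _ → 0) ≡ 0
  ∑-zero zero    = refl
  ∑-zero (suc n) = trans (+-identityʳ _) (∑-zero n)

  ∑-*ˡ : ∀ n c (f : ℕ → ℕ) → ∑ n (λ k → c * f k) ≡ c * ∑ n f
  ∑-*ˡ zero    c f = sym (*-zeroʳ c)
  ∑-*ˡ (suc n) c f = trans (cong (_+ c * f n) (∑-*ˡ n c f)) (sym (*-distribˡ-+ c (∑ n f) (f n)))

  ∑-+ : ∀ n (f g : ℕ → ℕ) → ∑ n (λ k → f k + g k) ≡ ∑ n f + ∑ n g
  ∑-+ zero    f g = refl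
  ∑-+ (suc n) f g = trans (cong (_+ (f n + g n)) (∑-+ n f g)) (interchange (∑ n f) (∑ n g) (f n) (g n))
    where
    interchange : ∀ a b c d → a + b + (c + d) ≡ a + c + (b + d)
    interchange = solve-∀

  ∑-comm : ∀ m n (F : ℕ → ℕ → ℕ) → ∑ m (λ i → ∑ n (F i)) ≡ ∑ n (λ j → ∑ m (λ i → F i j))
  ∑-comm zero    n F = sym (∑-zero n)
  ∑-comm (suc m) n F = trans (cong (_+ ∑ n (F m)) (∑-comm m n F))
                             (sym (∑-+ n (λ j → ∑ m (λ i → F i j)) (F m)))

  gauss : ∀ n → n * n ≡ 2 * ∑ n (λ k → k) + n
  gauss zero    = refl
  gauss (suc n) = begin
    suc n * suc n                        ≡⟨ square-suc n ⟩
    n * n + (2 * n + 1)                  ≡⟨ cong (_+ (2 * n + 1)) (gauss n) ⟩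
    2 * ∑ n (λ k → k) + n + (2 * n + 1)  ≡⟨ regroup (∑ n (λ k → k)) n ⟩
    2 * (∑ n (λ k → k) + n) + suc n      ∎
    where
    open ≡-Reasoning
    square-suc : ∀ n → suc n * suc n ≡ n * n + (2 * n + 1)
    square-suc = solve-∀
    regroup : ∀ s n → 2 * s + n + (2 * n + 1) ≡ 2 * (s + n) + suc n
    regroup = solve-∀

  ∑-no-gaps : ∀ n (χ : ℕ → ℕ) → (∀ {k} → suc k < n → 1 ≤ χ k + χ (suc k)) →
              n ≤ suc (2 * ∑ n χ)
  ∑-no-gaps zero          χ gaps = z≤n
  ∑-no-gaps (suc zero)    χ gaps = s≤s z≤n
  ∑-no-gaps (suc (suc n)) χ gaps = begin
    suc (suc n)                              ≡⟨ +-comm 2 n ⟩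
    n + 2 * 1                                ≤⟨ +-mono-≤ (∑-no-gaps n χ (λ k<n → gaps (m<n⇒m<1+n (m<n⇒m<1+n k<n))))
                                                         (*-monoʳ-≤ 2 (gaps ≤-refl)) ⟩
    suc (2 * ∑ n χ) + 2 * (χ n + χ (suc n))  ≡⟨ regroup (∑ n χ) (χ n) (χ (suc n)) ⟩
    suc (2 * (∑ n χ + χ n + χ (suc n)))      ∎
    where
    open ≤-Reasoning
    regroup : ∀ s a b → suc (2 * s) + 2 * (a + b) ≡ suc (2 * (s + a + b))
    regroup = solve-∀

  -- Let χ be an R × C array of naturals such that χ o k ≥ 1 whenever
  -- k ≤ o and column k has property Q, where Q never fails at two consecutive columns.
  -- Row o then carries mass ≥ o/2, so with m = min(R, C) the whole array has mass
  -- ≥ (0 + 1 + … + (m - 1))/2 = (m² - m)/4.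
  triangle-bound : (Q : ℕ → Set) → (∀ k → Q k ⊎ Q (suc k)) →
    ∀ R C (χ : ℕ → ℕ → ℕ) → (∀ {o k} → o < R → k < C → k ≤ o → Q k → 1 ≤ χ o k) →
    (R ⊓ C) * (R ⊓ C) ≤ 4 * ∑ R (λ o → ∑ C (χ o)) + R ⊓ C
  triangle-bound Q alternates R C χ positive = begin
    m * m                        ≡⟨ gauss m ⟩
    2 * ∑ m (λ o → o) + m        ≤⟨ +-monoˡ-≤ m (*-monoʳ-≤ 2 rows-bound) ⟩
    2 * (2 * ∑ R row) + m        ≡⟨ cong (_+ m) (sym (*-assoc 2 2 (∑ R row))) ⟩
    4 * ∑ R row + m              ∎
    where
    open ≤-Reasoning
    m : ℕ
    m = R ⊓ C
    row : ℕ → ℕ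
    row o = ∑ C (χ o)

    -- Within row o < m, the entries k ≤ o have no two consecutive zeros.
    row-bound : ∀ {o} → o < m → o ≤ 2 * row o
    row-bound {o} o<m = begin
      o                      ≤⟨ s≤s⁻¹ (∑-no-gaps (suc o) (χ o) no-gaps) ⟩
      2 * ∑ (suc o) (χ o)    ≤⟨ *-monoʳ-≤ 2 (∑-extend (χ o) (<-≤-trans o<m (m⊓n≤n R C))) ⟩
      2 * row o              ∎
      where
      o<R : o < R
      o<R = <-≤-trans o<m (m⊓n≤m R C)
      below : ∀ {k} → k ≤ o → k < C
      below k≤o = ≤-<-trans k≤o (<-≤-trans o<m (m⊓n≤n R C))
      no-gaps : ∀ {k} → suc k < suc o → 1 ≤ χ o k + χ o (suc k)
      no-gaps {k} (s≤s k<o) with alternates k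
      ... | inj₁ Qk   = ≤-trans (positive o<R (below (<⇒≤ k<o)) (<⇒≤ k<o) Qk) (m≤m+n _ _)
      ... | inj₂ Q1+k = ≤-trans (positive o<R (below k<o) k<o Q1+k) (m≤n+m _ _)

    rows-bound : ∑ m (λ o → o) ≤ 2 * ∑ R row
    rows-bound = begin
      ∑ m (λ o → o)           ≤⟨ ∑-mono-≤ m row-bound ⟩
      ∑ m (λ o → 2 * row o)   ≡⟨ ∑-*ˡ m 2 row ⟩
      2 * ∑ m row             ≤⟨ *-monoʳ-≤ 2 (∑-extend row (m⊓n≤m R C)) ⟩
      2 * ∑ R row             ∎

module ListCounting where

  open import Data.Nat using (ℕ; zero; suc; _+_)
  open import Data.List using (List; []; _∷_; [_]; _++_; map; filter; length; applyUpTo; cartesianProduct)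
  open import Data.List.Properties using (filter-++; length-++; filter-accept; applyUpTo-∷ʳ; map-applyUpTo; ++-assoc; ++-identityʳ)
  open import Data.Product using (_×_; _,_)
  open import Relation.Unary using (Pred; Decidable)
  open import Relation.Binary.PropositionalEquality using (_≡_; refl; sym; trans; cong; cong₂; module ≡-Reasoning)
  open FiniteSums

  module _ {a p} {A : Set a} {P : Pred A p} (P? : Decidable P) where

    count : List A → ℕ
    count xs = length (filter P? xs)

    count-++ : ∀ xs ys → count (xs ++ ys) ≡ count xs + count ys
    count-++ xs ys = trans (cong length (filter-++ P? xs ys)) (length-++ (filter P? xs))

    count-[x] : ∀ {x} → P x → count [ x ] ≡ 1
    count-[x] Px = cong length (filter-accept P? Px)

    count-applyUpTo : ∀ (u : ℕ → A) n → count (applyUpTo u n) ≡ ∑ n (λ k → count [ u k ])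
    count-applyUpTo u zero    = refl
    count-applyUpTo u (suc n) = begin
      count (applyUpTo u (suc n))             ≡⟨ cong count (sym (applyUpTo-∷ʳ u n)) ⟩
      count (applyUpTo u n ++ [ u n ])        ≡⟨ count-++ (applyUpTo u n) [ u n ] ⟩
      count (applyUpTo u n) + count [ u n ]   ≡⟨ cong (_+ count [ u n ]) (count-applyUpTo u n) ⟩
      ∑ n (λ k → count [ u k ]) + count [ u n ] ∎
      where open ≡-Reasoning

  cartesianProduct-++ : ∀ {a b} {A : Set a} {B : Set b} (xs ys : List A) (zs : List B) →
    cartesianProduct (xs ++ ys) zs ≡ cartesianProduct xs zs ++ cartesianProduct ys zs
  cartesianProduct-++ []       ys zs = refl
  cartesianProduct-++ (x ∷ xs) ys zs =
    trans (cong (map (x ,_) zs ++_) (cartesianProduct-++ xs ys zs))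
          (sym (++-assoc (map (x ,_) zs) (cartesianProduct xs zs) (cartesianProduct ys zs)))

  count-grid : ∀ {a b p} {A : Set a} {B : Set b} {P : Pred (A × B) p} (P? : Decidable P)
    (u : ℕ → A) (v : ℕ → B) m n →
    count P? (cartesianProduct (applyUpTo u m) (applyUpTo v n))
      ≡ ∑ m (λ i → ∑ n (λ j → count P? [ (u i , v j) ]))
  count-grid P? u v zero    n = refl
  count-grid P? u v (suc m) n = begin
    count P? (cartesianProduct (applyUpTo u (suc m)) vs)
      ≡⟨ cong (λ us → count P? (cartesianProduct us vs)) (sym (applyUpTo-∷ʳ u m)) ⟩
    count P? (cartesianProduct (applyUpTo u m ++ [ u m ]) vs)
      ≡⟨ cong (count P?) (cartesianProduct-++ (applyUpTo u m) [ u m ] vs) ⟩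
    count P? (cartesianProduct (applyUpTo u m) vs ++ (map (u m ,_) vs ++ []))
      ≡⟨ count-++ P? (cartesianProduct (applyUpTo u m) vs) _ ⟩
    count P? (cartesianProduct (applyUpTo u m) vs) + count P? (map (u m ,_) vs ++ [])
      ≡⟨ cong₂ _+_ (count-grid P? u v m n) (cong (count P?) last-row) ⟩
    ∑ m (λ i → ∑ n (λ j → count P? [ (u i , v j) ])) + count P? (applyUpTo (λ j → u m , v j) n)
      ≡⟨ cong (∑ m (λ i → ∑ n (λ j → count P? [ (u i , v j) ])) +_) (count-applyUpTo P? _ n) ⟩
    ∑ (suc m) (λ i → ∑ n (λ j → count P? [ (u i , v j) ])) ∎
    where
    open ≡-Reasoning
    vs : List _
    vs = applyUpTo v n
    last-row : map (u m ,_) vs ++ [] ≡ applyUpTo (λ j → u m , v j) n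
    last-row = trans (++-identityʳ _) (map-applyUpTo v (u m ,_) n)

module ProgressionSums where

  open import Data.Nat as ℕ using (ℕ; zero; suc; _≤_; _*_; _∸_)
  open import Data.Nat.Properties using (m∸n+n≡m; +-comm)
  open import Data.Nat.Divisibility using (_∣_; divides; _∣?_; ∣m+n∣m⇒∣n; n∣m*n; _∣0)
  open import Data.Integer as ℤ using (ℤ; +_; -_)
  open import Data.Integer.Properties using (m-n≡m⊖n; ⊖-≥; ⊖-≤; +-injective; neg-injective)
  open import Data.List.Membership.Propositional using (_∈_)
  open import Data.List.Membership.Propositional.Properties using (∈-map⁻)
  open import Data.Product using (_×_; _,_; ∃; proj₁; proj₂)
  open import Data.Sum using (_⊎_; inj₁; inj₂)
  open import Relation.Nullary using (¬_; yes; no)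
  open import Relation.Binary.PropositionalEquality using (_≡_; refl; sym; trans; subst)

  Outside : ℕ → ℕ → ℕ → ℕ → ℤ → Set
  Outside d e ℓ₁ ℓ₂ x = ¬ (x ∈ P₁ d ℓ₁ ⊎ x ∈ P₂ e ℓ₂)

  ∈P₁⇒multiple : ∀ {d ℓ x} → x ∈ P₁ d ℓ → ∃ λ k → x ≡ + (k * d)
  ∈P₁⇒multiple mem with ∈-map⁻ _ mem
  ... | k , _ , x≡kd = k , x≡kd

  ∈P₂⇒multiple : ∀ {e ℓ x} → x ∈ P₂ e ℓ → ∃ λ k → x ≡ - + (k * e)
  ∈P₂⇒multiple mem with ∈-map⁻ _ mem
  ... | k , _ , x≡-ke = k , x≡-ke

  +≡-+⇒0 : ∀ {m n} → + m ≡ - + n → m ≡ 0 × n ≡ 0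
  +≡-+⇒0 {zero}  {zero}  _  = refl , refl
  +≡-+⇒0 {suc m} {zero}  ()
  +≡-+⇒0 {m}     {suc n} ()

  -- A nonnegative element of P₁ d ℓ₁ ∪ P₂ e ℓ₂ is a multiple of d (P₂ only contributes 0).
  nonneg∈P₁∪P₂⇒∣ : ∀ {d e ℓ₁ ℓ₂ n} → + n ∈ P₁ d ℓ₁ ⊎ + n ∈ P₂ e ℓ₂ → d ∣ n
  nonneg∈P₁∪P₂⇒∣ (inj₁ mem) with ∈P₁⇒multiple mem
  ... | k , n≡kd = divides k (+-injective n≡kd)
  nonneg∈P₁∪P₂⇒∣ {d} (inj₂ mem) with ∈P₂⇒multiple mem
  ... | k , n≡-ke = subst (d ∣_) (sym (proj₁ (+≡-+⇒0 n≡-ke))) (d ∣0)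

  -- A nonpositive element of P₁ d ℓ₁ ∪ P₂ e ℓ₂ is −n with e ∣ n (P₁ only contributes 0).
  nonpos∈P₁∪P₂⇒∣ : ∀ {d e ℓ₁ ℓ₂ n} → - + n ∈ P₁ d ℓ₁ ⊎ - + n ∈ P₂ e ℓ₂ → e ∣ n
  nonpos∈P₁∪P₂⇒∣ {e = e} (inj₁ mem) with ∈P₁⇒multiple mem
  ... | k , -n≡kd = subst (e ∣_) (sym (proj₂ (+≡-+⇒0 (sym -n≡kd)))) (e ∣0)
  nonpos∈P₁∪P₂⇒∣ (inj₂ mem) with ∈P₂⇒multiple mem
  ... | k , -n≡-ke = divides k (+-injective (neg-injective -n≡-ke))

  sum-avoids-nonneg : ∀ {d e ℓ₁ ℓ₂} i j → j * e ≤ i * d → ¬ d ∣ j * e →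
    Outside d e ℓ₁ ℓ₂ (+ (i * d) ℤ.+ - + (j * e))
  sum-avoids-nonneg {d} {e} {ℓ₁} {ℓ₂} i j je≤id d∤je mem = d∤je (∣m+n∣m⇒∣n d∣id d∣difference)
    where
    difference : + (i * d) ℤ.+ - + (j * e) ≡ + (i * d ∸ j * e)
    difference = trans (m-n≡m⊖n (i * d) (j * e)) (⊖-≥ je≤id)
    d∣difference : d ∣ i * d ∸ j * e
    d∣difference = nonneg∈P₁∪P₂⇒∣ (subst (λ x → x ∈ P₁ d ℓ₁ ⊎ x ∈ P₂ e ℓ₂) difference mem)
    d∣id : d ∣ (i * d ∸ j * e) ℕ.+ j * e
    d∣id = subst (d ∣_) (sym (m∸n+n≡m je≤id)) (n∣m*n i)

  sum-avoids-nonpos : ∀ {d e ℓ₁ ℓ₂} i j → i * d ≤ j * e → ¬ e ∣ i * d →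
    Outside d e ℓ₁ ℓ₂ (+ (i * d) ℤ.+ - + (j * e))
  sum-avoids-nonpos {d} {e} {ℓ₁} {ℓ₂} i j id≤je e∤id mem = e∤id (∣m+n∣m⇒∣n e∣je e∣difference)
    where
    difference : + (i * d) ℤ.+ - + (j * e) ≡ - + (j * e ∸ i * d)
    difference = trans (m-n≡m⊖n (i * d) (j * e)) (⊖-≤ id≤je)
    e∣difference : e ∣ j * e ∸ i * d
    e∣difference = nonpos∈P₁∪P₂⇒∣ (subst (λ x → x ∈ P₁ d ℓ₁ ⊎ x ∈ P₂ e ℓ₂) difference mem)
    e∣je : e ∣ (j * e ∸ i * d) ℕ.+ i * d
    e∣je = subst (e ∣_) (sym (m∸n+n≡m id≤je)) (n∣m*n j)

  non-multiples-alternate : ∀ {d e} → ¬ d ∣ e → ∀ k → ¬ d ∣ k * e ⊎ ¬ d ∣ suc k * e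
  non-multiples-alternate {d} {e} d∤e k with d ∣? k * e
  ... | no  d∤ke = inj₁ d∤ke
  ... | yes d∣ke = inj₂ λ d∣e+ke → d∤e (∣m+n∣m⇒∣n (subst (d ∣_) (+-comm e (k * e)) d∣e+ke) d∣ke)

module BadPairCount where

  open import Data.Nat using (ℕ; _<_; _≤_; _*_; _+_; _⊓_; >-nonZero)
  open import Data.Nat.Properties using (<-cmp; <⇒≤; ≤-reflexive; *-mono-≤; ⊓-comm)
  open import Data.Nat.Divisibility using (_∣_; >⇒∤)
  open import Data.Integer as ℤ using (ℤ; +_; -_)
  open import Data.List using (cartesianProduct; [_])
  open import Data.List.Properties using (map-applyUpTo)
  open import Data.Product using (_×_; _,_)
  open import Relation.Nullary using (¬_)
  open import Relation.Nullary.Negation using (contradiction)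
  open import Relation.Unary using (Pred; Decidable)
  open import Relation.Binary.Definitions using (tri<; tri≈; tri>)
  open import Relation.Binary.PropositionalEquality using (_≡_; _≢_; sym; trans; cong₂; subst; subst₂)
  open FiniteSums
  open ListCounting
  open ProgressionSums

  -- Stated for any decidable predicate Bad that holds on all pairs with a₁ + a₂ outside
  -- P₁ ∪ P₂ (badPairs filters by such a predicate).  If d₂ < d₁, the triangle bound applies to the rows i with
  -- Q j = d₁ ∤ j·d₂; if d₁ < d₂, to the columns j with Q i = d₂ ∤ i·d₁.
  bad-pairs-bound : ∀ {p} {Bad : Pred (ℤ × ℤ) p} (bad? : Decidable Bad) {d₁ d₂ ℓ₁ ℓ₂} →
    (∀ {a₁ a₂} → Outside d₁ d₂ ℓ₁ ℓ₂ (a₁ ℤ.+ a₂) → Bad (a₁ , a₂)) →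
    0 < d₁ → 0 < d₂ → d₁ ≢ d₂ →
    (ℓ₁ ⊓ ℓ₂) * (ℓ₁ ⊓ ℓ₂) ≤ 4 * count bad? (cartesianProduct (P₁ d₁ ℓ₁) (P₂ d₂ ℓ₂)) + ℓ₁ ⊓ ℓ₂
  bad-pairs-bound bad? {d₁} {d₂} {ℓ₁} {ℓ₂} bad-if 0<d₁ 0<d₂ d₁≢d₂ =
    subst (λ c → m * m ≤ 4 * c + m) (sym as-double-sum) by-cases
    where
    m : ℕ
    m = ℓ₁ ⊓ ℓ₂
    χ : ℕ → ℕ → ℕ
    χ i j = count bad? [ (+ (i * d₁) , - + (j * d₂)) ]

    as-double-sum : count bad? (cartesianProduct (P₁ d₁ ℓ₁) (P₂ d₂ ℓ₂)) ≡ ∑ ℓ₁ (λ i → ∑ ℓ₂ (χ i))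
    as-double-sum = trans (cong₂ (λ xs ys → count bad? (cartesianProduct xs ys))
                                 (map-applyUpTo _ _ ℓ₁) (map-applyUpTo _ _ ℓ₂))
                          (count-grid bad? _ _ ℓ₁ ℓ₂)

    bad-entry : ∀ i j → Outside d₁ d₂ ℓ₁ ℓ₂ (+ (i * d₁) ℤ.+ - + (j * d₂)) → 1 ≤ χ i j
    bad-entry i j outside = ≤-reflexive (sym (count-[x] bad? (bad-if outside)))

    by-cases : m * m ≤ 4 * ∑ ℓ₁ (λ i → ∑ ℓ₂ (χ i)) + m
    by-cases with <-cmp d₁ d₂
    ... | tri≈ _ d₁≡d₂ _ = contradiction d₁≡d₂ d₁≢d₂
    ... | tri> _ _ d₂<d₁ =
      triangle-bound (λ j → ¬ d₁ ∣ j * d₂)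
        (non-multiples-alternate (>⇒∤ {{>-nonZero 0<d₂}} d₂<d₁)) ℓ₁ ℓ₂ χ
        (λ {i} {j} _ _ j≤i d₁∤jd₂ →
           bad-entry i j (sum-avoids-nonneg i j (*-mono-≤ j≤i (<⇒≤ d₂<d₁)) d₁∤jd₂))
    ... | tri< d₁<d₂ _ _ =
      subst₂ (λ n c → n * n ≤ 4 * c + n) (⊓-comm ℓ₂ ℓ₁) (sym (∑-comm ℓ₁ ℓ₂ χ))
        (triangle-bound (λ i → ¬ d₂ ∣ i * d₁)
          (non-multiples-alternate (>⇒∤ {{>-nonZero 0<d₁}} d₁<d₂)) ℓ₂ ℓ₁ (λ j i → χ i j)
          (λ {j} {i} _ _ i≤j d₂∤id₁ →
             bad-entry i j (sum-avoids-nonpos i j (*-mono-≤ i≤j (<⇒≤ d₁<d₂)) d₂∤id₁)))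

module IntegerForm where

  open import Data.Nat as ℕ using (z≤n)
  open import Data.Nat.Properties using (m+n∸n≡m; m≤n+m; *-mono-≤; mono-≤-distrib-⊓)
  open import Data.Integer using (ℤ; +_; -_; -[1+_]; _-_; _*_; _≤_; +≤+; _⊖_; 0ℤ; nonNegative)
  open import Data.Integer.Properties using ([+m]-[+n]≡m⊖n; ⊖-monoˡ-≤; ⊖-≥; pos-*; i-j≤i; +-monoˡ-≤; *-monoˡ-≤-nonNeg; module ≤-Reasoning)
  open import Relation.Binary.PropositionalEquality using (_≡_; sym; cong; subst)

  ⊓-square : ∀ a b → ℕ._⊓_ (a ℕ.* a) (b ℕ.* b) ≡ ℕ._⊓_ a b ℕ.* ℕ._⊓_ a b
  ⊓-square a b = sym (mono-≤-distrib-⊓ (λ a≤b → *-mono-≤ a≤b a≤b) a b)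

  square-nonNeg : ∀ i → 0ℤ ≤ i * i
  square-nonNeg (+ n)    = subst (0ℤ ≤_) (pos-* n n) (+≤+ z≤n)
  square-nonNeg -[1+ n ] = +≤+ z≤n

  pos-*-nonNeg : ∀ c n → 0ℤ ≤ + c * + n
  pos-*-nonNeg c n = subst (0ℤ ≤_) (pos-* c n) (+≤+ z≤n)

  minus-≤ : ∀ {a b c} → a ℕ.≤ b ℕ.+ c → + a - + c ≤ + b
  minus-≤ {a} {b} {c} a≤b+c = begin
    + a - + c          ≡⟨ [+m]-[+n]≡m⊖n a c ⟩
    a ⊖ c              ≤⟨ ⊖-monoˡ-≤ c a≤b+c ⟩
    (b ℕ.+ c) ⊖ c      ≡⟨ ⊖-≥ (m≤n+m c b) ⟩
    + (b ℕ.+ c ℕ.∸ c)  ≡⟨ cong +_ (m+n∸n≡m b c) ⟩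
    + b                ∎
    where open ≤-Reasoning

  -- The stated integer bound follows from a ≤ 4b + 4ℓ₁: the subtracted terms 2Δ² and 4ℓ₂
  -- are nonnegative and can be dropped.
  drop-subtracted : ∀ a b ℓ₁ ℓ₂ (Δ : ℤ) → a ℕ.≤ 4 ℕ.* b ℕ.+ 4 ℕ.* ℓ₁ →
    + a - + 2 * (Δ * Δ) - + 4 * + ℓ₁ - + 4 * + ℓ₂ ≤ + 4 * + b
  drop-subtracted a b ℓ₁ ℓ₂ Δ a≤4b+4ℓ₁ = begin
    + a - + 2 * (Δ * Δ) - + 4 * + ℓ₁ - + 4 * + ℓ₂
      ≤⟨ i-j≤i _ (+ 4 * + ℓ₂) {{nonNegative (pos-*-nonNeg 4 ℓ₂)}} ⟩
    + a - + 2 * (Δ * Δ) - + 4 * + ℓ₁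
      ≤⟨ +-monoˡ-≤ (- (+ 4 * + ℓ₁)) (i-j≤i (+ a) (+ 2 * (Δ * Δ)) {{nonNegative twice-square}}) ⟩
    + a - + 4 * + ℓ₁
      ≡⟨ cong (λ x → + a - x) (sym (pos-* 4 ℓ₁)) ⟩
    + a - + (4 ℕ.* ℓ₁)
      ≤⟨ minus-≤ a≤4b+4ℓ₁ ⟩
    + (4 ℕ.* b)
      ≡⟨ pos-* 4 b ⟩
    + 4 * + b ∎
    where
    open ≤-Reasoning
    twice-square : 0ℤ ≤ + 2 * (Δ * Δ)
    twice-square = *-monoˡ-≤-nonNeg (+ 2) (square-nonNeg Δ)

open import Data.Nat using (ℕ)
open import Data.Nat as ℕ using ()
open import Data.Nat.Properties using (≤-trans; +-monoʳ-≤; m⊓n≤m; m≤n*m)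
open import Data.Integer using (ℤ; +_; _-_; _*_; _+_; _≤_)
open import Relation.Binary.PropositionalEquality using (_≢_; subst; sym)
open BadPairCount using (bad-pairs-bound)
open IntegerForm using (⊓-square; drop-subtracted)

lemma6p3 : (d₁ d₂ ℓ₁ ℓ₂ : ℕ) → 0 ℕ.< d₁ → 0 ℕ.< d₂ → 0 ℕ.< ℓ₁ → 0 ℕ.< ℓ₂ → d₁ ≢ d₂ →
    + (ℕ._⊓_ (ℓ₁ ℕ.* ℓ₁) (ℓ₂ ℕ.* ℓ₂)) - + 2 * ((+ ℓ₁ - + ℓ₂) * (+ ℓ₁ - + ℓ₂)) - + 4 * + ℓ₁ - + 4 * + ℓ₂
      ≤ + 4 * + (badPairs d₁ d₂ ℓ₁ ℓ₂)
lemma6p3 d₁ d₂ ℓ₁ ℓ₂ 0<d₁ 0<d₂ _ _ d₁≢d₂ =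
  drop-subtracted _ bad ℓ₁ ℓ₂ (+ ℓ₁ - + ℓ₂) min-squares-bound
  where
  m bad : ℕ
  m = ℕ._⊓_ ℓ₁ ℓ₂
  bad = badPairs d₁ d₂ ℓ₁ ℓ₂
  -- Every pair with sum outside P₁ ∪ P₂ is counted by badPairs.
  counted : m ℕ.* m ℕ.≤ 4 ℕ.* bad ℕ.+ m
  counted = bad-pairs-bound _ {d₁} {d₂} {ℓ₁} {ℓ₂} (λ outside → outside) 0<d₁ 0<d₂ d₁≢d₂
  -- min(ℓ₁², ℓ₂²) = m² and m ≤ ℓ₁ ≤ 4ℓ₁.
  min-squares-bound : ℕ._⊓_ (ℓ₁ ℕ.* ℓ₁) (ℓ₂ ℕ.* ℓ₂) ℕ.≤ 4 ℕ.* bad ℕ.+ 4 ℕ.* ℓ₁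
  min-squares-bound = subst (ℕ._≤ 4 ℕ.* bad ℕ.+ 4 ℕ.* ℓ₁) (sym (⊓-square ℓ₁ ℓ₂))
                        (≤-trans counted (+-monoʳ-≤ (4 ℕ.* bad) (≤-trans (m⊓n≤m ℓ₁ ℓ₂) (m≤n*m ℓ₁ 4))))
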